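{- Every nonempty tiling $T\subseteq\Lambda$ contains a dense triple, i.e. a triple of the form $(j-1)\,j\,(j+1)$ for some $j\in\{2,\dots,n-1\}$.
   Context: Fix an integer $n\ge 2$, $[n]=\{1,\dots,n\}$, and let $\Lambda$ be the set of triples $ijk$ with $i<j<k$ in $[n]$. For a quadruple $i<j<k<l$, its stick is the ordered sequence $(ijk,ijl,ikl,jkl)$. A subset of $\Lambda$ is a tiling if for every quadruple $i<j<k<l$ its intersection with the stick, written as a 0/1 string along the stick order, is one of $0000,1000,1100,1110,1111,0111,0011,0001$ (these are the inversion sets of rhombus tilings of the zonogon $Z(n;2)$). -}

module Defs where

open import Data.Nat using (ℕ; suc; _≤_; _<_)
open import Data.Bool using (Bool; true; false)
open import Data.Product using (_×_; Σ; ∃; _,_)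
open import Relation.Binary.PropositionalEquality using (_≡_)

Subset3 : Set
Subset3 = ℕ → ℕ → ℕ → Bool

InΛ : ℕ → ℕ → ℕ → ℕ → Set
InΛ n i j k = 1 ≤ i × i < j × j < k × k ≤ n

SubsetΛ : ℕ → Subset3 → Set
SubsetΛ n T = ∀ i j k → T i j k ≡ true → InΛ n i j k

data Allowed : Bool → Bool → Bool → Bool → Set where
  a0000 : Allowed false false false false
  a1000 : Allowed true  false false false
  a1100 : Allowed true  true  false false
  a1110 : Allowed true  true  true  false
  a1111 : Allowed true  true  true  true
  a0111 : Allowed false true  true  true
  a0011 : Allowed false false true  true
  a0001 : Allowed false false false true

-- T is a tiling of Z(n;2): T ⊆ Λ and for every quadruple i<j<k<l in [n]
-- the restriction of T to the stick (ijk, ijl, ikl, jkl) is allowed.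
IsTiling : ℕ → Subset3 → Set
IsTiling n T =
  SubsetΛ n T ×
  (∀ i j k l → 1 ≤ i → i < j → j < k → k < l → l ≤ n →
     Allowed (T i j k) (T i j l) (T i k l) (T j k l))

Nonempty : Subset3 → Set
Nonempty T = ∃ λ i → ∃ λ j → ∃ λ k → T i j k ≡ true

-- A non-dense triple ijk of a tiling can always be traded for a narrower one
-- (smaller k − i): if j ≠ i+1 the stick of i < i+1 < j < k carries ijk in its
-- third slot, and if j = i+1 but k ≠ i+2 the stick of i < i+1 < i+2 < k
-- carries it in its second slot; in both cases an allowed string then also
-- contains the first or the last triple of that stick, both narrower than ijk.
-- Since widths cannot decrease forever, some triple of the tiling is dense.
module Submission where

open import Defs
open import Data.Nat using (ℕ; suc; _≤_; _<_; _∸_; _≟_; s≤s)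
open import Data.Nat.Properties
  using (≤-refl; ≤∧≢⇒<; ∸-monoˡ-≤; ∸-monoˡ-<; ∸-monoʳ-<; n<1+n; <⇒≤; <-trans)
open import Data.Nat.Induction using (<-wellFounded)
open import Induction.WellFounded using (Acc; acc)
open import Data.Bool using (true)
open import Data.Product using (∃; ∃₂; _×_; _,_; proj₁; proj₂)
open import Data.Sum using (_⊎_; inj₁; inj₂)
open import Relation.Nullary using (yes; no)
open import Relation.Binary.PropositionalEquality using (_≡_; refl)

Allowed-second⇒first⊎last : ∀ {a b c d} → Allowed a b c d → b ≡ true →
                            a ≡ true ⊎ d ≡ true
Allowed-second⇒first⊎last a1100 _ = inj₁ refl
Allowed-second⇒first⊎last a1110 _ = inj₁ refl
Allowed-second⇒first⊎last a1111 _ = inj₁ refl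
Allowed-second⇒first⊎last a0111 _ = inj₂ refl

Allowed-third⇒first⊎last : ∀ {a b c d} → Allowed a b c d → c ≡ true →
                           a ≡ true ⊎ d ≡ true
Allowed-third⇒first⊎last a1110 _ = inj₁ refl
Allowed-third⇒first⊎last a1111 _ = inj₁ refl
Allowed-third⇒first⊎last a0111 _ = inj₂ refl
Allowed-third⇒first⊎last a0011 _ = inj₂ refl

module _ {n : ℕ} {T : Subset3} (tiling : IsTiling n T) where

  private
    T⊆Λ : SubsetΛ n T
    T⊆Λ = proj₁ tiling

    stick : ∀ i j k l → 1 ≤ i → i < j → j < k → k < l → l ≤ n →
            Allowed (T i j k) (T i j l) (T i k l) (T j k l)
    stick = proj₂ tiling

  NarrowerThan : ℕ → ℕ → Set
  NarrowerThan i k = ∃₂ λ i′ j′ → ∃ λ k′ → T i′ j′ k′ ≡ true × k′ ∸ i′ < k ∸ i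

  DenseTriple : Set
  DenseTriple = ∃ λ j → 2 ≤ j × j ≤ n ∸ 1 × T (j ∸ 1) j (suc j) ≡ true

  narrower-from-stickEnds : ∀ {i c k} → i < c → c < k →
                            T i (suc i) c ≡ true ⊎ T (suc i) c k ≡ true →
                            NarrowerThan i k
  narrower-from-stickEnds {i} {c} i<c c<k (inj₁ t) =
    i , suc i , c , t , ∸-monoˡ-< c<k (<⇒≤ i<c)
  narrower-from-stickEnds {i} {c} {k} i<c c<k (inj₂ t) =
    suc i , c , k , t , ∸-monoʳ-< (n<1+n i) (<-trans i<c c<k)

  dense⊎narrower : ∀ {i j k} → T i j k ≡ true → DenseTriple ⊎ NarrowerThan i k
  dense⊎narrower {i} {j} {k} ijk∈T with T⊆Λ i j k ijk∈T
  ... | 1≤i , i<j , j<k , k≤n with suc i ≟ j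
  ...   | no i+1≢j = inj₂ (narrower-from-stickEnds i<j j<k
            (Allowed-third⇒first⊎last (stick i (suc i) j k 1≤i ≤-refl i+1<j j<k k≤n) ijk∈T))
    where
      i+1<j : suc i < j
      i+1<j = ≤∧≢⇒< i<j i+1≢j
  ...   | yes refl with suc j ≟ k
  ...     | yes refl = inj₁ (j , s≤s 1≤i , ∸-monoˡ-≤ 1 k≤n , ijk∈T)
  ...     | no j+1≢k = inj₂ (narrower-from-stickEnds (<-trans i<j (n<1+n j)) j+1<k
            (Allowed-second⇒first⊎last (stick i j (suc j) k 1≤i i<j ≤-refl j+1<k k≤n) ijk∈T))
    where
      j+1<k : suc j < k
      j+1<k = ≤∧≢⇒< j<k j+1≢k

  denseTriple-acc : ∀ {i j k} → Acc _<_ (k ∸ i) → T i j k ≡ true → DenseTriple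
  denseTriple-acc (acc narrower-acc) ijk∈T with dense⊎narrower ijk∈T
  ... | inj₁ dense                = dense
  ... | inj₂ (_ , _ , _ , t , lt) = denseTriple-acc (narrower-acc lt) t

  denseTriple : ∀ {i j k} → T i j k ≡ true → DenseTriple
  denseTriple {i} {k = k} = denseTriple-acc (<-wellFounded (k ∸ i))

lemma3 : (n : ℕ) → 2 ≤ n → (T : Subset3) → IsTiling n T → Nonempty T →
    ∃ λ j → 2 ≤ j × j ≤ n ∸ 1 × T (j ∸ 1) j (suc j) ≡ true
lemma3 _ _ _ tiling (_ , _ , _ , ijk∈T) = denseTriple tiling ijk∈T
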